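{- Let $G=(V,E)$ be a simple undirected graph, let $S\subseteq\binom{V}{2}$ be a set of terminal pairs, and let $a^{\mathsf T}x\geq b$ be a facet-defining inequality for $\mathrm{MultC}(G,S)$ such that $\{x: a^{\mathsf T}x\geq b\}\neq\{x: x_{e'}\geq 0\}$ for all $e'\in E$. Then every edge $e\in E(\mathrm{supp}(a))$ lies on an $s$-$t$-path in $\mathrm{supp}(a)$ for some $\{s,t\}\in S$. In particular, every leaf of $\mathrm{supp}(a)$ is a terminal.
   Context: Given a graph $G=(V,E)$ and $S\subseteq\binom{V}{2}$, an ($S$-)multicut is a set $\delta\subseteq E$ such that for every $\{s,t\}\in S$ the nodes $s$ and $t$ lie in different components of $G-\delta$. A node $v$ is a terminal if $\{v,w\}\in S$ for some $w$. For $F\subseteq E$, $x^F\in\mathbb{R}^E$ is its incidence vector. The multicut polytope is $\mathrm{MultC}^{\square}(G,S)=\mathrm{conv}\{x^\delta:\delta \text{ an } S\text{ -multicut}\}$ and the multicut dominant is $\mathrm{MultC}(G,S)=\mathrm{MultC}^{\square}(G,S)+\mathbb{R}^E_{\geq 0}$. For a valid inequality $a^{\mathsf T}x\geq b$, its support graph $\mathrm{supp}(a)$ is the subgraph of $G$ induced by the edge set $\{e\in E: a_e\neq 0\}$ (i.e., these edges together with their endpoints).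
   Formalization: The facet-defining inequality $a^{\mathsf T}x\geq b$ has rational a and b, and MultC(G,S) is taken in ℚ^E rather than ℝ^E. -}

module Defs where

open import Data.Nat using (ℕ; zero; suc)
open import Data.Fin using (Fin; zero; suc)
open import Data.Bool using (Bool; true; false)
open import Data.Product using (Σ; ∃; ∃-syntax; _×_; _,_; proj₁; proj₂)
open import Data.Sum using (_⊎_)
open import Data.List using (List; []; _∷_)
open import Data.List.Membership.Propositional using (_∈_; _∉_)
open import Data.Rational using (ℚ; 0ℚ; 1ℚ; _+_; _*_; _≤_; _≥_)
open import Relation.Binary.PropositionalEquality using (_≡_; _≢_)
open import Relation.Nullary using (¬_)
open import Function.Bundles using (_⇔_)

Σℚ : (k : ℕ) → (Fin k → ℚ) → ℚ
Σℚ zero    f = 0ℚ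
Σℚ (suc k) f = f zero + Σℚ k (λ i → f (suc i))

-- Graphs: vertex set V = Fin n, edge set E = Fin m,
-- each edge given by its (ordered representation of its) two endpoints.

Ends : ℕ → ℕ → Set
Ends n m = Fin m → Fin n × Fin n

Joins : ∀ {n m} → Ends n m → Fin m → Fin n → Fin n → Set
Joins ends e u v = (ends e ≡ (u , v)) ⊎ (ends e ≡ (v , u))

Simple : ∀ {n m} → Ends n m → Set
Simple {n} {m} ends =
  (∀ e → proj₁ (ends e) ≢ proj₂ (ends e)) ×
  (∀ e e' → Joins ends e' (proj₁ (ends e)) (proj₂ (ends e)) → e ≡ e')

Pairs : ℕ → Set
Pairs n = List (Fin n × Fin n)

WellFormedPairs : ∀ {n} → Pairs n → Set
WellFormedPairs S = ∀ {s t} → (s , t) ∈ S → s ≢ t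

data Conn {n m} (ends : Ends n m) (keep : Fin m → Set) : Fin n → Fin n → Set where
  here : ∀ {v} → Conn ends keep v v
  step : ∀ {u v w} (e : Fin m) → keep e → Joins ends e u v →
         Conn ends keep v w → Conn ends keep u w

Multicut : ∀ {n m} → Ends n m → Pairs n → (Fin m → Bool) → Set
Multicut ends S δ = ∀ {s t} → (s , t) ∈ S → ¬ Conn ends (λ e → δ e ≡ false) s t

[_] : Bool → ℚ
[ true ]  = 1ℚ
[ false ] = 0ℚ

Point : ℕ → Set
Point m = Fin m → ℚ

-- membership in the multicut dominant MultC(G,S) = conv{x^δ} + ℝ^E_{≥0}
-- (points taken in ℚ^E)
InMultC : ∀ {n m} → Ends n m → Pairs n → Point m → Set
InMultC {n} {m} ends S x =
  Σ ℕ λ k → Σ (Fin k → ℚ) λ μ → Σ (Fin k → Fin m → Bool) λ δ →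
    (∀ i → μ i ≥ 0ℚ) × (Σℚ k μ ≡ 1ℚ) × (∀ i → Multicut ends S (δ i)) ×
    (∀ j → Σℚ k (λ i → μ i * [ δ i j ]) ≤ x j)

dot : ∀ {m} → Point m → Point m → ℚ
dot {m} a x = Σℚ m (λ j → a j * x j)

AffinelyIndependent : ∀ {m k} → (Fin k → Point m) → Set
AffinelyIndependent {m} {k} p =
  ∀ (λ' : Fin k → ℚ) → Σℚ k λ' ≡ 0ℚ →
  (∀ j → Σℚ k (λ i → λ' i * p i j) ≡ 0ℚ) → ∀ i → λ' i ≡ 0ℚ

DimGE : ∀ {m} → (Point m → Set) → ℕ → Set
DimGE {m} X d = Σ (Fin (suc d) → Point m) λ p → (∀ i → X (p i)) × AffinelyIndependent p

DimEq : ∀ {m} → (Point m → Set) → ℕ → Set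
DimEq X d = DimGE X d × ¬ DimGE X (suc d)

Valid : ∀ {m} → (Point m → Set) → Point m → ℚ → Set
Valid P a b = ∀ x → P x → dot a x ≥ b

FacetDefining : ∀ {m} → (Point m → Set) → Point m → ℚ → Set
FacetDefining P a b =
  Valid P a b ×
  Σ ℕ λ d → DimEq P (suc d) × DimEq (λ x → P x × (dot a x ≡ b)) d

SameAsNonneg : ∀ {m} → Point m → ℚ → Fin m → Set
SameAsNonneg a b e = ∀ x → (dot a x ≥ b) ⇔ (x e ≥ 0ℚ)

InSupp : ∀ {m} → Point m → Fin m → Set
InSupp a e = a e ≢ 0ℚ

data Path {n m} (ends : Ends n m) (keep : Fin m → Set)
     : Fin n → Fin n → List (Fin n) → List (Fin m) → Set where
  nil  : ∀ {v} → Path ends keep v v (v ∷ []) []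
  cons : ∀ {u v w vs es} (e : Fin m) → keep e → Joins ends e u v →
         Path ends keep v w vs es → u ∉ vs →
         Path ends keep u w (u ∷ vs) (e ∷ es)

Incident : ∀ {n m} → Ends n m → Fin m → Fin n → Set
Incident ends e v = (proj₁ (ends e) ≡ v) ⊎ (proj₂ (ends e) ≡ v)

Leaf : ∀ {n m} → Ends n m → Point m → Fin n → Set
Leaf ends a v =
  Σ _ λ e → InSupp a e × Incident ends e v ×
    (∀ e' → InSupp a e' → Incident ends e' v → e' ≡ e)

Terminal : ∀ {n} → Pairs n → Fin n → Set
Terminal S v = ∃ λ w → ((v , w) ∈ S) ⊎ ((w , v) ∈ S)

-- A valid inequality for an up-closed set has a ≥ 0. For e ∈ supp(a), some point x of the facet
-- has x_e ≠ 0: otherwise the facet lies in {x_e = 0}, so raising one of its points along e_f and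
-- along e_e would increase the dimension unless a is supported on e alone, and then the facet
-- would be {x_e ≥ 0}. Writing x as a dominated convex combination of multicuts, some multicut δ
-- with δ_e = 1 is tight. Uncutting e and cutting every edge outside supp(a) gives a set of weight
-- b − a_e < b, so it leaves some pair {s,t} of S connected; the s-t path it leaves open lies in
-- supp(a), and it uses e because δ separates s and t. A leaf of supp(a) on such a path must be
-- one of its ends, hence a terminal.

module Submission where

open import Defs
open import Algebra.Bundles using (CommutativeRing)
open import Data.Bool using (Bool; true; false)
open import Data.Bool.Properties using () renaming (_≟_ to _≟ᵇ_)
open import Data.Empty using (⊥-elim)
open import Data.Fin using (Fin; zero; suc)
open import Data.Fin.Properties using (all?; ¬∀⟶∃¬; suc-injective) renaming (_≟_ to _≟ᶠ_)
open import Data.List using (List; []; _∷_; filter; allFin)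
open import Data.List.Membership.Propositional using (_∈_; find; lose)
open import Data.List.Membership.Propositional.Properties using (∈-filter⁺; ∈-filter⁻; ∈-allFin)
import Data.List.Membership.DecPropositional as DecMembership
open import Data.List.Relation.Unary.Any using (here; there; any?)
open import Data.Nat using (ℕ; zero; suc)
open import Data.Product using (Σ; ∃; _×_; _,_; proj₁; proj₂; uncurry)
open import Data.Rational
  using (ℚ; 0ℚ; 1ℚ; _+_; _*_; _-_; -_; _≤_; _≥_; _<_; _>_; 1/_; Positive)
open import Data.Rational.Base using (≢-nonZero; nonNegative; positive)
open import Data.Rational.Properties
open import Data.Rational.Solver using (module +-*-Solver)
open import Data.Sum using (_⊎_; inj₁; inj₂)
open import Data.Vec.Functional using () renaming (_∷_ to _∷ᵛ_)
open import Function using (_∘_; mk⇔)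
open import Relation.Binary using (tri<; tri≈; tri>)
open import Relation.Binary.PropositionalEquality hiding ([_])
open import Relation.Nullary using (¬_; Dec; yes; no; does; contradiction)
open import Relation.Nullary.Decidable using (map′; _⊎-dec_; _×-dec_)
open import Relation.Unary using (Decidable)

open import Algebra.Properties.Semiring.Sum (CommutativeRing.semiring +-*-commutativeRing)
  using (sum; sum-cong-≗; ∑-distrib-+; ∑-comm; *-distribˡ-sum; sum-replicate-zero)
open import Algebra.Properties.Group +-0-group using (identityʳ-unique; x∙y⁻¹≈ε⇒x≈y)
open import Algebra.Apartness.Properties.HeytingCommutativeRing heytingCommutativeRing
  using (x#0y#0→xy#0)

-- Rational arithmetic and finite sums

x*y≡0∧y≢0⇒x≡0 : ∀ {x y} → x * y ≡ 0ℚ → y ≢ 0ℚ → x ≡ 0ℚ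
x*y≡0∧y≢0⇒x≡0 {x} xy≡0 y≢0 with x ≟ 0ℚ
... | yes x≡0 = x≡0
... | no x≢0  = contradiction xy≡0 (x#0y#0→xy#0 x≢0 y≢0)

*-cancelˡ-≡-pos : ∀ r .{{_ : Positive r}} {p q} → r * p ≡ r * q → p ≡ q
*-cancelˡ-≡-pos r eq =
  ≤-antisym (*-cancelˡ-≤-pos r (≤-reflexive eq)) (*-cancelˡ-≤-pos r (≤-reflexive (sym eq)))

Σℚ-sum : ∀ k (f : Fin k → ℚ) → Σℚ k f ≡ sum f
Σℚ-sum zero    f = refl
Σℚ-sum (suc k) f = cong (f zero +_) (Σℚ-sum k (f ∘ suc))

Σℚ-cong : ∀ {k} {f g : Fin k → ℚ} → (∀ i → f i ≡ g i) → Σℚ k f ≡ Σℚ k g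
Σℚ-cong {k} {f} {g} f≗g rewrite Σℚ-sum k f | Σℚ-sum k g = sum-cong-≗ f≗g

Σℚ-distrib-+ : ∀ k (f g : Fin k → ℚ) → Σℚ k (λ i → f i + g i) ≡ Σℚ k f + Σℚ k g
Σℚ-distrib-+ k f g rewrite Σℚ-sum k (λ i → f i + g i) | Σℚ-sum k f | Σℚ-sum k g =
  ∑-distrib-+ f g

Σℚ-*ˡ : ∀ k c (f : Fin k → ℚ) → Σℚ k (λ i → c * f i) ≡ c * Σℚ k f
Σℚ-*ˡ k c f rewrite Σℚ-sum k (λ i → c * f i) | Σℚ-sum k f = sym (*-distribˡ-sum c f)

Σℚ-zero : ∀ k → Σℚ k (λ _ → 0ℚ) ≡ 0ℚ
Σℚ-zero k rewrite Σℚ-sum k (λ _ → 0ℚ) = sum-replicate-zero k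

Σℚ-comm : ∀ k l (F : Fin k → Fin l → ℚ) →
  Σℚ k (λ i → Σℚ l (F i)) ≡ Σℚ l (λ j → Σℚ k (λ i → F i j))
Σℚ-comm k l F = begin
  Σℚ k (λ i → Σℚ l (F i))          ≡⟨ Σℚ-cong (λ i → Σℚ-sum l (F i)) ⟩
  Σℚ k (λ i → sum (F i))            ≡⟨ Σℚ-sum k _ ⟩
  sum (λ i → sum (F i))             ≡⟨ ∑-comm F ⟩
  sum (λ j → sum (λ i → F i j))     ≡⟨ Σℚ-sum l _ ⟨
  Σℚ l (λ j → sum (λ i → F i j))    ≡⟨ Σℚ-cong (λ j → Σℚ-sum k (λ i → F i j)) ⟨
  Σℚ l (λ j → Σℚ k (λ i → F i j))  ∎
  where open ≡-Reasoning

Σℚ-mono-≤ : ∀ {k} {f g : Fin k → ℚ} → (∀ i → f i ≤ g i) → Σℚ k f ≤ Σℚ k g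
Σℚ-mono-≤ {zero}  f≤g = ≤-refl
Σℚ-mono-≤ {suc k} f≤g = +-mono-≤ (f≤g zero) (Σℚ-mono-≤ (f≤g ∘ suc))

Σℚ-mono-< : ∀ {k} {f g : Fin k → ℚ} → (∀ i → f i ≤ g i) → ∀ i → f i < g i →
  Σℚ k f < Σℚ k g
Σℚ-mono-< {suc k} f≤g zero    fi<gi = +-mono-<-≤ fi<gi (Σℚ-mono-≤ (f≤g ∘ suc))
Σℚ-mono-< {suc k} f≤g (suc i) fi<gi = +-mono-≤-< (f≤g zero) (Σℚ-mono-< (f≤g ∘ suc) i fi<gi)

Σℚ-tight : ∀ {k} {f g : Fin k → ℚ} → (∀ i → f i ≤ g i) → Σℚ k g ≤ Σℚ k f →
  ∀ i → f i ≡ g i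
Σℚ-tight f≤g Σg≤Σf i with <-cmp _ _
... | tri≈ _ fi≡gi _ = fi≡gi
... | tri< fi<gi _ _ = contradiction (<-≤-trans (Σℚ-mono-< f≤g i fi<gi) Σg≤Σf) (<-irrefl refl)
... | tri> _ _ fi>gi = contradiction (<-≤-trans fi>gi (f≤g i)) (<-irrefl refl)

Σℚ-single : ∀ {k} (f : Fin k → ℚ) i → (∀ j → j ≢ i → f j ≡ 0ℚ) → Σℚ k f ≡ f i
Σℚ-single {suc k} f zero    others = begin
  f zero + Σℚ k (f ∘ suc)  ≡⟨ cong (f zero +_) (trans (Σℚ-cong (λ j → others (suc j) λ ())) (Σℚ-zero k)) ⟩
  f zero + 0ℚ              ≡⟨ +-identityʳ (f zero) ⟩
  f zero                   ∎
  where open ≡-Reasoning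
Σℚ-single {suc k} f (suc i) others = begin
  f zero + Σℚ k (f ∘ suc)  ≡⟨ cong (_+ Σℚ k (f ∘ suc)) (others zero λ ()) ⟩
  0ℚ + Σℚ k (f ∘ suc)      ≡⟨ +-identityˡ _ ⟩
  Σℚ k (f ∘ suc)           ≡⟨ Σℚ-single (f ∘ suc) i (λ j j≢i → others (suc j) (j≢i ∘ suc-injective)) ⟩
  f (suc i)                ∎
  where open ≡-Reasoning

Σℚ-nonZero⇒term-nonZero : ∀ {k} (f : Fin k → ℚ) → Σℚ k f ≢ 0ℚ → ∃ λ i → f i ≢ 0ℚ
Σℚ-nonZero⇒term-nonZero {k} f Σf≢0 = ¬∀⟶∃¬ k _ (λ i → f i ≟ 0ℚ) all-zero⇒Σ≡0
  where
  all-zero⇒Σ≡0 : ¬ (∀ i → f i ≡ 0ℚ)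
  all-zero⇒Σ≡0 f≡0 = Σf≢0 (trans (Σℚ-cong f≡0) (Σℚ-zero k))

Σℚ-weighted-const : ∀ {k} (μ : Fin k → ℚ) → Σℚ k μ ≡ 1ℚ → ∀ b → Σℚ k (λ i → μ i * b) ≡ b
Σℚ-weighted-const {k} μ Σμ≡1 b = begin
  Σℚ k (λ i → μ i * b)  ≡⟨ Σℚ-cong (λ i → *-comm (μ i) b) ⟩
  Σℚ k (λ i → b * μ i)  ≡⟨ Σℚ-*ˡ k b μ ⟩
  b * Σℚ k μ            ≡⟨ cong (b *_) Σμ≡1 ⟩
  b * 1ℚ                ≡⟨ *-identityʳ b ⟩
  b                     ∎
  where open ≡-Reasoning

module _ {k} {μ : Fin k → ℚ} (μ≥0 : ∀ i → μ i ≥ 0ℚ) (Σμ≡1 : Σℚ k μ ≡ 1ℚ)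
         {v : Fin k → ℚ} {b : ℚ} (b≤v : ∀ i → b ≤ v i) where

  private
    weighted-≤ : ∀ i → μ i * b ≤ μ i * v i
    weighted-≤ i = *-monoˡ-≤-nonNeg (μ i) {{nonNegative (μ≥0 i)}} (b≤v i)

  weighted-average-≥ : b ≤ Σℚ k (λ i → μ i * v i)
  weighted-average-≥ =
    ≤-trans (≤-reflexive (sym (Σℚ-weighted-const μ Σμ≡1 b))) (Σℚ-mono-≤ weighted-≤)

  weighted-average-tight : Σℚ k (λ i → μ i * v i) ≤ b → ∀ i → μ i ≢ 0ℚ → v i ≡ b
  weighted-average-tight avg≤b i μi≢0 =
    sym (*-cancelˡ-≡-pos (μ i) (Σℚ-tight weighted-≤ avg≤Σμb i))
    where
    instance
      _ = nonNeg∧nonZero⇒pos (μ i) {{nonNegative (μ≥0 i)}} {{≢-nonZero μi≢0}}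
    avg≤Σμb : Σℚ k (λ i → μ i * v i) ≤ Σℚ k (λ i → μ i * b)
    avg≤Σμb = ≤-trans avg≤b (≤-reflexive (sym (Σℚ-weighted-const μ Σμ≡1 b)))

bounded-ray⇒slope-≥0 : ∀ {b c s} → (∀ t → t ≥ 0ℚ → b ≤ c + t * s) → s ≥ 0ℚ
bounded-ray⇒slope-≥0 {b} {c} {s} bounded with 0ℚ ≤? s
... | yes s≥0 = s≥0
... | no s≱0  = contradiction (<-≤-trans value<b (bounded t t≥0)) (<-irrefl refl)
  where
  r = - s
  r>0 : r > 0ℚ
  r>0 = neg-antimono-< (≰⇒> s≱0)
  instance
    _ = positive r>0
    _ = pos⇒nonZero r
    _ = pos⇒nonNeg (1/ r) {{1/pos⇒pos r}}
  D = c - b + 1ℚ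
  D≥0 : D ≥ 0ℚ
  D≥0 = +-mono-≤ (p≤q⇒0≤q-p b≤c) (nonNegative⁻¹ 1ℚ)
    where
    b≤c : b ≤ c
    b≤c = ≤-trans (bounded 0ℚ ≤-refl) (≤-reflexive (trans (cong (c +_) (*-zeroˡ s)) (+-identityʳ c)))
    p≤q⇒0≤q-p : ∀ {p q} → p ≤ q → 0ℚ ≤ q - p
    p≤q⇒0≤q-p {p} p≤q = ≤-trans (≤-reflexive (sym (+-inverseʳ p))) (+-monoˡ-≤ (- p) p≤q)
  t = D * 1/ r
  t≥0 : t ≥ 0ℚ
  t≥0 = ≤-trans (≤-reflexive (sym (*-zeroˡ (1/ r)))) (*-monoʳ-≤-nonNeg (1/ r) D≥0)
  value<b : c + t * s < b
  value<b = begin-strict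
    c + t * s            ≡⟨ rearrange c D (1/ r) s ⟩
    c - D * (r * 1/ r)   ≡⟨ cong (λ u → c - D * u) (*-inverseʳ r) ⟩
    c - D * 1ℚ           ≡⟨ cancel c b ⟩
    b - 1ℚ               <⟨ +-monoʳ-< b (negative⁻¹ (- 1ℚ)) ⟩
    b + 0ℚ               ≡⟨ +-identityʳ b ⟩
    b                    ∎
    where
    open ≤-Reasoning
    open +-*-Solver
    rearrange : ∀ c D w s → c + D * w * s ≡ c - D * (- s * w)
    rearrange = solve 4 (λ c D w s → c :+ D :* w :* s := c :- D :* (:- s :* w)) refl
    cancel : ∀ c b → c - (c - b + 1ℚ) * 1ℚ ≡ b - 1ℚ
    cancel = solve 2 (λ c b → c :- (c :- b :+ con 1ℚ) :* con 1ℚ := b :- con 1ℚ) refl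

-- Points, unit vectors and dot products

incidence : ∀ {m} → (Fin m → Bool) → Point m
incidence δ j = [ δ j ]

indicator-≥0 : ∀ β → [ β ] ≥ 0ℚ
indicator-≥0 true  = nonNegative⁻¹ 1ℚ
indicator-≥0 false = ≤-refl

*-indicator-nonZero : ∀ {μ β} → μ * [ β ] ≢ 0ℚ → μ ≢ 0ℚ × β ≡ true
*-indicator-nonZero {μ} {true}  μ*1≢0 = (λ μ≡0 → μ*1≢0 (trans (*-identityʳ μ) μ≡0)) , refl
*-indicator-nonZero {μ} {false} μ*0≢0 = contradiction (*-zeroʳ μ) μ*0≢0

unit : ∀ {m} → Fin m → Point m
unit f = incidence (λ j → does (j ≟ᶠ f))

unit-self : ∀ {m} (f : Fin m) → unit f f ≡ 1ℚ
unit-self f with f ≟ᶠ f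
... | yes _   = refl
... | no f≢f  = contradiction refl f≢f

unit-other : ∀ {m} {f j : Fin m} → j ≢ f → unit f j ≡ 0ℚ
unit-other {f = f} {j} j≢f with j ≟ᶠ f
... | yes j≡f = contradiction j≡f j≢f
... | no _    = refl

_+[_]_ : ∀ {m} → Point m → ℚ → Fin m → Point m
(x +[ t ] f) j = x j + t * unit f j

+[]-≥ : ∀ {m} (x : Point m) {t} f → t ≥ 0ℚ → ∀ j → x j ≤ (x +[ t ] f) j
+[]-≥ x {t} f t≥0 j = ≤-trans (≤-reflexive (sym (+-identityʳ (x j))))
  (+-monoʳ-≤ (x j) t*u≥0)
  where
  t*u≥0 : t * unit f j ≥ 0ℚ
  t*u≥0 = ≤-trans (≤-reflexive (sym (*-zeroʳ t)))
            (*-monoˡ-≤-nonNeg t {{nonNegative t≥0}} (indicator-≥0 (does (j ≟ᶠ f))))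

+[]-self : ∀ {m} (x : Point m) t f → (x +[ t ] f) f ≡ x f + t
+[]-self x t f = trans (cong (λ u → x f + t * u) (unit-self f)) (cong (x f +_) (*-identityʳ t))

+[]-other : ∀ {m} (x : Point m) t {f j} → j ≢ f → (x +[ t ] f) j ≡ x j
+[]-other x t {f} {j} j≢f =
  trans (cong (λ u → x j + t * u) (unit-other j≢f)) (trans (cong (x j +_) (*-zeroʳ t)) (+-identityʳ (x j)))

module _ {m : ℕ} where

  dot-comm : ∀ (a x : Point m) → dot a x ≡ dot x a
  dot-comm a x = Σℚ-cong (λ j → *-comm (a j) (x j))

  dot-concentrated : ∀ (a x : Point m) e → (∀ f → f ≢ e → a f ≡ 0ℚ) → dot a x ≡ a e * x e
  dot-concentrated a x e others =
    Σℚ-single _ e (λ f f≢e → trans (cong (_* x f) (others f f≢e)) (*-zeroˡ (x f)))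

  dot-unitʳ : ∀ (a : Point m) f → dot a (unit f) ≡ a f
  dot-unitʳ a f = begin
    dot a (unit f)      ≡⟨ Σℚ-single _ f (λ j j≢f → trans (cong (a j *_) (unit-other j≢f)) (*-zeroʳ (a j))) ⟩
    a f * unit f f      ≡⟨ cong (a f *_) (unit-self f) ⟩
    a f * 1ℚ            ≡⟨ *-identityʳ (a f) ⟩
    a f                 ∎
    where open ≡-Reasoning

  dot-unitˡ : ∀ f (x : Point m) → dot (unit f) x ≡ x f
  dot-unitˡ f x = trans (dot-comm (unit f) x) (dot-unitʳ x f)

  dot-+[] : ∀ (a x : Point m) t f → dot a (x +[ t ] f) ≡ dot a x + t * a f
  dot-+[] a x t f = begin
    Σℚ m (λ j → a j * (x j + t * unit f j))        ≡⟨ Σℚ-cong (λ j → distribute (a j) (x j) t (unit f j)) ⟩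
    Σℚ m (λ j → a j * x j + t * (a j * unit f j))  ≡⟨ Σℚ-distrib-+ m _ _ ⟩
    dot a x + Σℚ m (λ j → t * (a j * unit f j))    ≡⟨ cong (dot a x +_) (Σℚ-*ˡ m t _) ⟩
    dot a x + t * dot a (unit f)                   ≡⟨ cong (λ u → dot a x + t * u) (dot-unitʳ a f) ⟩
    dot a x + t * a f                              ∎
    where
    open ≡-Reasoning
    open +-*-Solver
    distribute : ∀ a x t u → a * (x + t * u) ≡ a * x + t * (a * u)
    distribute = solve 4 (λ a x t u → a :* (x :+ t :* u) := a :* x :+ t :* (a :* u)) refl

  dot-Σ : ∀ {k} (a : Point m) (c : Fin k → ℚ) (q : Fin k → Point m) →
    dot a (λ j → Σℚ k (λ i → c i * q i j)) ≡ Σℚ k (λ i → c i * dot a (q i))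
  dot-Σ {k} a c q = begin
    Σℚ m (λ j → a j * Σℚ k (λ i → c i * q i j))   ≡⟨ Σℚ-cong (λ j → sym (Σℚ-*ˡ k (a j) _)) ⟩
    Σℚ m (λ j → Σℚ k (λ i → a j * (c i * q i j))) ≡⟨ Σℚ-comm m k _ ⟩
    Σℚ k (λ i → Σℚ m (λ j → a j * (c i * q i j))) ≡⟨ Σℚ-cong (λ i → Σℚ-cong (λ j → swap (a j) (c i) (q i j))) ⟩
    Σℚ k (λ i → Σℚ m (λ j → c i * (a j * q i j))) ≡⟨ Σℚ-cong (λ i → Σℚ-*ˡ m (c i) _) ⟩
    Σℚ k (λ i → c i * dot a (q i))               ∎
    where
    open ≡-Reasoning
    open +-*-Solver
    swap : ∀ x y z → x * (y * z) ≡ y * (x * z)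
    swap = solve 3 (λ x y z → x :* (y :* z) := y :* (x :* z)) refl

AffinelyIndependent-∷ : ∀ {m k} {p : Fin k → Point m} (g : Point m) {c w} →
  (∀ i → dot g (p i) ≡ c) → dot g w ≢ c →
  AffinelyIndependent p → AffinelyIndependent (w ∷ᵛ p)
AffinelyIndependent-∷ {m} {k} {p} g {c} {w} on-hyperplane off-hyperplane indep λ' Σλ'≡0 combination≡0 =
  λ where
    zero    → λ₀≡0
    (suc i) → indep L ΣL≡0 L-combination≡0 i
  where
  open ≡-Reasoning
  λ₀ = λ' zero
  L = λ' ∘ suc
  ΣL = Σℚ k L
  combination-value : λ₀ * dot g w + c * ΣL ≡ 0ℚ
  combination-value = begin
    λ₀ * dot g w + c * ΣL                        ≡⟨ cong (λ₀ * dot g w +_) (Σℚ-*ˡ k c L) ⟨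
    λ₀ * dot g w + Σℚ k (λ i → c * L i)          ≡⟨ cong (λ₀ * dot g w +_) (Σℚ-cong λ i →
                                                      trans (*-comm c (L i)) (cong (L i *_) (sym (on-hyperplane i)))) ⟩
    Σℚ (suc k) (λ i → λ' i * dot g ((w ∷ᵛ p) i))  ≡⟨ dot-Σ g λ' (w ∷ᵛ p) ⟨
    dot g (λ j → Σℚ (suc k) (λ i → λ' i * (w ∷ᵛ p) i j))
                                                 ≡⟨ Σℚ-cong (λ j → trans (cong (g j *_) (combination≡0 j)) (*-zeroʳ (g j))) ⟩
    Σℚ m (λ _ → 0ℚ)                              ≡⟨ Σℚ-zero m ⟩
    0ℚ                                           ∎
  gw-c≢0 : dot g w - c ≢ 0ℚ
  gw-c≢0 = off-hyperplane ∘ x∙y⁻¹≈ε⇒x≈y (dot g w) c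
  λ₀≡0 : λ₀ ≡ 0ℚ
  λ₀≡0 = x*y≡0∧y≢0⇒x≡0 (begin
    λ₀ * (dot g w - c)                           ≡⟨ regroup λ₀ (dot g w) c ΣL ⟩
    (λ₀ * dot g w + c * ΣL) - c * (λ₀ + ΣL)      ≡⟨ cong₂ (λ u v → u - c * v) combination-value Σλ'≡0 ⟩
    0ℚ - c * 0ℚ                                  ≡⟨ cong (λ u → 0ℚ - u) (*-zeroʳ c) ⟩
    0ℚ                                           ∎) gw-c≢0
    where
    open +-*-Solver
    regroup : ∀ l y c s → l * (y - c) ≡ (l * y + c * s) - c * (l + s)
    regroup = solve 4 (λ l y c s → l :* (y :- c) := (l :* y :+ c :* s) :- c :* (l :+ s)) refl
  ΣL≡0 : ΣL ≡ 0ℚ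
  ΣL≡0 = begin
    ΣL         ≡⟨ +-identityˡ ΣL ⟨
    0ℚ + ΣL    ≡⟨ cong (_+ ΣL) λ₀≡0 ⟨
    λ₀ + ΣL    ≡⟨ Σλ'≡0 ⟩
    0ℚ         ∎
  L-combination≡0 : ∀ j → Σℚ k (λ i → L i * p i j) ≡ 0ℚ
  L-combination≡0 j = begin
    Σℚ k (λ i → L i * p i j)              ≡⟨ +-identityˡ _ ⟨
    0ℚ + Σℚ k (λ i → L i * p i j)         ≡⟨ cong (_+ Σℚ k (λ i → L i * p i j)) λ₀w≡0 ⟨
    λ₀ * w j + Σℚ k (λ i → L i * p i j)   ≡⟨ combination≡0 j ⟩
    0ℚ                                    ∎
    where
    λ₀w≡0 : λ₀ * w j ≡ 0ℚ
    λ₀w≡0 = trans (cong (_* w j) λ₀≡0) (*-zeroˡ (w j))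

-- Connectivity and simple paths

_∈ᶠ?_ : ∀ {k} (i : Fin k) (is : List (Fin k)) → Dec (i ∈ is)
_∈ᶠ?_ = DecMembership._∈?_ _≟ᶠ_

module _ {n m : ℕ} (ends : Ends n m) where

  Joins-sym : ∀ {e u v} → Joins ends e u v → Joins ends e v u
  Joins-sym (inj₁ eq) = inj₂ eq
  Joins-sym (inj₂ eq) = inj₁ eq

  Joins⇒Incidentˡ : ∀ {e u v} → Joins ends e u v → Incident ends e u
  Joins⇒Incidentˡ (inj₁ eq) rewrite eq = inj₁ refl
  Joins⇒Incidentˡ (inj₂ eq) rewrite eq = inj₂ refl

  Joins⇒Incidentʳ : ∀ {e u v} → Joins ends e u v → Incident ends e v
  Joins⇒Incidentʳ = Joins⇒Incidentˡ ∘ Joins-sym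

  Incident-Joins : ∀ {e u v x} → Joins ends e u v → Incident ends e x → x ≡ u ⊎ x ≡ v
  Incident-Joins (inj₁ eq) (inj₁ x≡) rewrite eq = inj₁ (sym x≡)
  Incident-Joins (inj₁ eq) (inj₂ x≡) rewrite eq = inj₂ (sym x≡)
  Incident-Joins (inj₂ eq) (inj₁ x≡) rewrite eq = inj₂ (sym x≡)
  Incident-Joins (inj₂ eq) (inj₂ x≡) rewrite eq = inj₁ (sym x≡)

  Conn-mono : ∀ {K K' : Fin m → Set} → (∀ f → K f → K' f) →
    ∀ {u v} → Conn ends K u v → Conn ends K' u v
  Conn-mono K⊆K' here             = here
  Conn-mono K⊆K' (step e k j c) = step e (K⊆K' e k) j (Conn-mono K⊆K' c)

  Conn-trans : ∀ {K u v w} → Conn ends K u v → Conn ends K v w → Conn ends K u w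
  Conn-trans here           c' = c'
  Conn-trans (step e k j c) c' = step e k j (Conn-trans c c')

  private
    ConnIn : List (Fin m) → Fin n → Fin n → Set
    ConnIn L = Conn ends (_∈ L)

    -- a walk using f ∷ L either avoids f or crosses f in one of its two directions
    Crossing : List (Fin m) → Fin m → Fin n → Fin n → Set
    Crossing L f u v =
      (ConnIn L u (proj₁ (ends f)) × ConnIn L (proj₂ (ends f)) v) ⊎
      (ConnIn L u (proj₂ (ends f)) × ConnIn L (proj₁ (ends f)) v)

    lift : ∀ {f L u v} → ConnIn L u v → ConnIn (f ∷ L) u v
    lift = Conn-mono (λ _ → there)

    cross : ∀ {f L u v x y} → Joins ends f x y →
      ConnIn L u x → ConnIn L y v → ConnIn (f ∷ L) u v
    cross {f} j c c' = Conn-trans (lift c) (step f (here refl) j (lift c'))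

    from-Crossing : ∀ {f L u v} → ConnIn L u v ⊎ Crossing L f u v → ConnIn (f ∷ L) u v
    from-Crossing             (inj₁ c)                = lift c
    from-Crossing             (inj₂ (inj₁ (c , c'))) = cross (inj₁ refl) c c'
    from-Crossing             (inj₂ (inj₂ (c , c'))) = cross (inj₂ refl) c c'

    to-Crossing : ∀ {f L u v} → ConnIn (f ∷ L) u v → ConnIn L u v ⊎ Crossing L f u v
    to-Crossing here = inj₁ here
    to-Crossing (step e (there e∈L) j c) with to-Crossing c
    ... | inj₁ c'                 = inj₁ (step e e∈L j c')
    ... | inj₂ (inj₁ (c₁ , c₂)) = inj₂ (inj₁ (step e e∈L j c₁ , c₂))
    ... | inj₂ (inj₂ (c₁ , c₂)) = inj₂ (inj₂ (step e e∈L j c₁ , c₂))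
    to-Crossing {f} (step .f (here refl) (inj₁ eq) c) with ends f | eq | to-Crossing c
    ... | _ | refl | inj₁ c'                = inj₂ (inj₁ (here , c'))
    ... | _ | refl | inj₂ (inj₁ (_ , c'))  = inj₂ (inj₁ (here , c'))
    ... | _ | refl | inj₂ (inj₂ (_ , c'))  = inj₁ c'
    to-Crossing {f} (step .f (here refl) (inj₂ eq) c) with ends f | eq | to-Crossing c
    ... | _ | refl | inj₁ c'                = inj₂ (inj₂ (here , c'))
    ... | _ | refl | inj₂ (inj₁ (_ , c'))  = inj₁ c'
    ... | _ | refl | inj₂ (inj₂ (_ , c'))  = inj₂ (inj₂ (here , c'))

    ConnIn-[] : ∀ {u v} → ConnIn [] u v → u ≡ v
    ConnIn-[] here = refl

    ConnIn? : ∀ L u v → Dec (ConnIn L u v)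
    ConnIn? [] u v with u ≟ᶠ v
    ... | yes refl = yes here
    ... | no u≢v   = no (u≢v ∘ ConnIn-[])
    ConnIn? (f ∷ L) u v = map′ from-Crossing to-Crossing
      (ConnIn? L u v ⊎-dec
        ((ConnIn? L u x ×-dec ConnIn? L y v) ⊎-dec (ConnIn? L u y ×-dec ConnIn? L x v)))
      where
      x = proj₁ (ends f)
      y = proj₂ (ends f)

  Conn? : ∀ {K : Fin m → Set} → Decidable K → ∀ u v → Dec (Conn ends K u v)
  Conn? K? u v = map′
    (Conn-mono (λ f f∈ → proj₂ (∈-filter⁻ K? {xs = allFin m} f∈)))
    (Conn-mono (λ f k → ∈-filter⁺ K? (∈-allFin f) k))
    (ConnIn? (filter K? (allFin m)) u v)

  Path-start∈ : ∀ {K u w vs es} → Path ends K u w vs es → u ∈ vs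
  Path-start∈ nil                = here refl
  Path-start∈ (cons _ _ _ _ _) = here refl

  Path-mono : ∀ {K K' : Fin m → Set} → (∀ f → K f → K' f) →
    ∀ {u w vs es} → Path ends K u w vs es → Path ends K' u w vs es
  Path-mono K⊆K' nil                  = nil
  Path-mono K⊆K' (cons e k j p u∉) = cons e (K⊆K' e k) j (Path-mono K⊆K' p) u∉

  Path⇒Conn : ∀ {K K' u w vs es} → Path ends K u w vs es → (∀ f → f ∈ es → K' f) →
    Conn ends K' u w
  Path⇒Conn nil                _  = here
  Path⇒Conn (cons e _ j p _) K' = step e (K' e (here refl)) j (Path⇒Conn p (λ f → K' f ∘ there))

  Path-kept : ∀ {K u w vs es f} → Path ends K u w vs es → f ∈ es → K f
  Path-kept (cons _ k _ _ _) (here refl) = k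
  Path-kept (cons _ _ _ p _) (there f∈)  = Path-kept p f∈

  Path-Incident∈ : ∀ {K u w vs es f x} → Path ends K u w vs es → f ∈ es →
    Incident ends f x → x ∈ vs
  Path-Incident∈ (cons _ _ j p _) (here refl) inc with Incident-Joins j inc
  ... | inj₁ refl = here refl
  ... | inj₂ refl = there (Path-start∈ p)
  Path-Incident∈ (cons _ _ _ p _) (there f∈) inc = there (Path-Incident∈ p f∈ inc)

  Path-suffix : ∀ {K v w vs es x} → Path ends K v w vs es → x ∈ vs →
    ∃ λ vs' → ∃ λ es' → Path ends K x w vs' es'
  Path-suffix nil                  (here refl) = _ , _ , nil
  Path-suffix p@(cons _ _ _ _ _) (here refl) = _ , _ , p
  Path-suffix (cons _ _ _ p _)   (there x∈)  = Path-suffix p x∈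

  -- cycles are cut out by jumping to the later occurrence of a repeated vertex
  Conn⇒Path : ∀ {K u w} → Conn ends K u w → ∃ λ vs → ∃ λ es → Path ends K u w vs es
  Conn⇒Path here = _ , _ , nil
  Conn⇒Path {u = u} (step e k j c) with Conn⇒Path c
  ... | vs , es , p with u ∈ᶠ? vs
  ...   | yes u∈ = Path-suffix p u∈
  ...   | no u∉  = _ , _ , cons e k j p u∉

  Path-interior : ∀ {K s t vs es x} → Path ends K s t vs es → x ∈ vs → x ≢ s → x ≢ t →
    ∃ λ e → ∃ λ e' → e ∈ es × e' ∈ es × e ≢ e' × Incident ends e x × Incident ends e' x
  Path-interior nil               (here refl) x≢s _ = contradiction refl x≢s
  Path-interior (cons _ _ _ _ _) (here refl) x≢s _ = contradiction refl x≢s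
  Path-interior {x = x} (cons {v = w} g _ j p s∉) (there x∈) _ x≢t with x ≟ᶠ w
  ... | no x≢w with Path-interior p x∈ x≢w x≢t
  ...   | e , e' , e∈ , e'∈ , rest = e , e' , there e∈ , there e'∈ , rest
  Path-interior (cons g _ j nil s∉) (there x∈) _ x≢t | yes refl = contradiction refl x≢t
  Path-interior (cons g _ j (cons g' _ j' p _) s∉) (there x∈) _ _ | yes refl =
    g , g' , here refl , there (here refl) , g≢g' , Joins⇒Incidentʳ j , Joins⇒Incidentˡ j'
    where
    g≢g' : g ≢ g'
    g≢g' refl with Incident-Joins j' (Joins⇒Incidentˡ j)
    ... | inj₁ refl = s∉ (here refl)
    ... | inj₂ refl = s∉ (there (Path-start∈ p))

  Path-leaf⇒endpoint : ∀ {K s t vs es e x} → (∀ f → K f → Incident ends f x → f ≡ e) →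
    Path ends K s t vs es → e ∈ es → Incident ends e x → x ≡ s ⊎ x ≡ t
  Path-leaf⇒endpoint {s = s} {t} {x = x} unique p e∈ inc with x ≟ᶠ s | x ≟ᶠ t
  ... | yes x≡s | _       = inj₁ x≡s
  ... | no _    | yes x≡t = inj₂ x≡t
  ... | no x≢s  | no x≢t  with Path-interior p (Path-Incident∈ p e∈ inc) x≢s x≢t
  ...   | f , f' , f∈ , f'∈ , f≢f' , inc-f , inc-f' =
    contradiction (trans (unique f (Path-kept p f∈) inc-f) (sym (unique f' (Path-kept p f'∈) inc-f'))) f≢f'

-- Up-closed sets and their facets

UpwardClosed : ∀ {m} → (Point m → Set) → Set
UpwardClosed X = ∀ {x y} → X x → (∀ j → x j ≤ y j) → X y

TerminalPathThrough : ∀ {n m} → Ends n m → Pairs n → Point m → Fin m → Set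
TerminalPathThrough {n} {m} ends S a e =
  Σ (Fin n) λ s → Σ (Fin n) λ t → ((s , t) ∈ S) ×
    Σ (List (Fin n)) λ vs → Σ (List (Fin m)) λ es → Path ends (InSupp a) s t vs es × (e ∈ es)

valid⇒nonneg : ∀ {m} {X : Point m → Set} {a b x₀} → UpwardClosed X → X x₀ → Valid X a b →
  ∀ f → a f ≥ 0ℚ
valid⇒nonneg {a = a} {x₀ = x₀} upward x₀∈X valid f = bounded-ray⇒slope-≥0 {c = dot a x₀} λ t t≥0 →
  ≤-trans (valid _ (upward x₀∈X (+[]-≥ x₀ f t≥0))) (≤-reflexive (dot-+[] a x₀ t f))

-- Raising p₀ along e_f and then along e_e leaves the hyperplanes a·x = b and x_e = 0 in turn.
concentrated-face : ∀ {m d} {X : Point m → Set} {a b} → UpwardClosed X → ¬ DimGE X (suc (suc d)) →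
  (p : Fin (suc d) → Point m) → (∀ i → X (p i)) → (∀ i → dot a (p i) ≡ b) → AffinelyIndependent p →
  ∀ e → (∀ i → p i e ≡ 0ℚ) → ∀ f → f ≢ e → a f ≡ 0ℚ
concentrated-face {X = X} {a = a} {b} upward low-dim p p∈X on-face indep e pe≡0 f f≢e with a f ≟ 0ℚ
... | yes af≡0 = af≡0
... | no af≢0  = contradiction (q , q∈X , q-indep) low-dim
  where
  open ≡-Reasoning
  w₁ = p zero +[ 1ℚ ] f
  w₂ = p zero +[ 1ℚ ] e
  q = w₂ ∷ᵛ (w₁ ∷ᵛ p)
  q∈X : ∀ i → X (q i)
  q∈X zero          = upward (p∈X zero) (+[]-≥ (p zero) e (nonNegative⁻¹ 1ℚ))
  q∈X (suc zero)    = upward (p∈X zero) (+[]-≥ (p zero) f (nonNegative⁻¹ 1ℚ))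
  q∈X (suc (suc i)) = p∈X i
  w₁-off-face : dot a w₁ ≢ b
  w₁-off-face aw₁≡b = af≢0 (trans (sym (*-identityˡ (a f))) (identityʳ-unique b (1ℚ * a f) b+af≡b))
    where
    b+af≡b : b + 1ℚ * a f ≡ b
    b+af≡b = begin
      b + 1ℚ * a f               ≡⟨ cong (_+ 1ℚ * a f) (on-face zero) ⟨
      dot a (p zero) + 1ℚ * a f  ≡⟨ dot-+[] a (p zero) 1ℚ f ⟨
      dot a w₁                   ≡⟨ aw₁≡b ⟩
      b                          ∎
  w₁∷p-in-e-hyperplane : ∀ i → dot (unit e) ((w₁ ∷ᵛ p) i) ≡ 0ℚ
  w₁∷p-in-e-hyperplane zero    = trans (dot-unitˡ e w₁) (trans (+[]-other (p zero) 1ℚ (f≢e ∘ sym)) (pe≡0 zero))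
  w₁∷p-in-e-hyperplane (suc i) = trans (dot-unitˡ e (p i)) (pe≡0 i)
  w₂-off-e-hyperplane : dot (unit e) w₂ ≢ 0ℚ
  w₂-off-e-hyperplane ew₂≡0 = contradiction (begin
    1ℚ                 ≡⟨ +-identityˡ 1ℚ ⟨
    0ℚ + 1ℚ            ≡⟨ cong (_+ 1ℚ) (pe≡0 zero) ⟨
    p zero e + 1ℚ      ≡⟨ +[]-self (p zero) 1ℚ e ⟨
    w₂ e               ≡⟨ dot-unitˡ e w₂ ⟨
    dot (unit e) w₂    ≡⟨ ew₂≡0 ⟩
    0ℚ                 ∎) λ ()
  q-indep : AffinelyIndependent q
  q-indep = AffinelyIndependent-∷ (unit e) w₁∷p-in-e-hyperplane w₂-off-e-hyperplane
              (AffinelyIndependent-∷ a on-face w₁-off-face indep)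

concentrated⇒SameAsNonneg : ∀ {m} {a : Point m} {e} → a e > 0ℚ → (∀ f → f ≢ e → a f ≡ 0ℚ) →
  SameAsNonneg a 0ℚ e
concentrated⇒SameAsNonneg {a = a} {e} ae>0 others x = mk⇔ from-dot to-dot
  where
  open ≤-Reasoning
  instance
    _ = positive ae>0
    _ = nonNegative (<⇒≤ ae>0)
  ax≡ : dot a x ≡ a e * x e
  ax≡ = dot-concentrated a x e others
  from-dot : dot a x ≥ 0ℚ → x e ≥ 0ℚ
  from-dot ax≥0 = *-cancelˡ-≤-pos (a e) (begin
    a e * 0ℚ   ≡⟨ *-zeroʳ (a e) ⟩
    0ℚ         ≤⟨ ax≥0 ⟩
    dot a x    ≡⟨ ax≡ ⟩
    a e * x e  ∎)
  to-dot : x e ≥ 0ℚ → dot a x ≥ 0ℚ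
  to-dot xe≥0 = begin
    0ℚ         ≡⟨ *-zeroʳ (a e) ⟨
    a e * 0ℚ   ≤⟨ *-monoˡ-≤-nonNeg (a e) xe≥0 ⟩
    a e * x e  ≡⟨ ax≡ ⟨
    dot a x    ∎

-- The multicut dominant

module _ {n m : ℕ} (ends : Ends n m) (S : Pairs n) where

  Multicut-or-Connected : ∀ δ → Multicut ends S δ ⊎
    (∃ λ s → ∃ λ t → (s , t) ∈ S × Conn ends (λ f → δ f ≡ false) s t)
  Multicut-or-Connected δ with any? (uncurry (Conn? ends (λ f → δ f ≟ᵇ false))) S
  ... | yes connected = let (s , t) , st∈S , c = find connected in inj₂ (s , t , st∈S , c)
  ... | no separated  = inj₁ (λ st∈S c → separated (lose st∈S c))

  cut-all-Multicut : WellFormedPairs S → Multicut ends S (λ _ → true)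
  cut-all-Multicut well-formed st∈S here = well-formed st∈S refl

  InMultC-upward : UpwardClosed (InMultC ends S)
  InMultC-upward (k , μ , δ , μ≥0 , Σμ≡1 , δ-cut , y≤x) x≤y =
    k , μ , δ , μ≥0 , Σμ≡1 , δ-cut , λ j → ≤-trans (y≤x j) (x≤y j)

  Multicut⇒InMultC : ∀ {δ} → Multicut ends S δ → InMultC ends S (incidence δ)
  Multicut⇒InMultC {δ} δ-cut =
    1 , (λ _ → 1ℚ) , (λ _ → δ) , (λ _ → nonNegative⁻¹ 1ℚ) , +-identityʳ 1ℚ , (λ _ → δ-cut) ,
    λ j → ≤-reflexive (trans (+-identityʳ _) (*-identityˡ _))

  module _ {a : Point m} {b : ℚ} (valid : Valid (InMultC ends S) a b) where

    tight-point⇒tight-cut : (∀ j → a j ≥ 0ℚ) → ∀ {e x} → a e > 0ℚ →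
      InMultC ends S x → dot a x ≡ b → x e ≢ 0ℚ →
      ∃ λ δ → Multicut ends S δ × δ e ≡ true × dot a (incidence δ) ≡ b
    tight-point⇒tight-cut a≥0 {e} {x} ae>0 (k , μ , δ , μ≥0 , Σμ≡1 , δ-cut , y≤x) ax≡b xe≢0 =
      δ i , δ-cut i , proj₂ μi≢0×δie≡true ,
      weighted-average-tight μ≥0 Σμ≡1 b≤value avg≤b i (proj₁ μi≢0×δie≡true)
      where
      y : Point m
      y j = Σℚ k (λ i → μ i * incidence (δ i) j)
      value : Fin k → ℚ
      value i = dot a (incidence (δ i))
      b≤value : ∀ i → b ≤ value i
      b≤value i = valid _ (Multicut⇒InMultC (δ-cut i))
      ay≡avg : dot a y ≡ Σℚ k (λ i → μ i * value i)
      ay≡avg = dot-Σ a μ (incidence ∘ δ)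
      ay≤ax : ∀ j → a j * y j ≤ a j * x j
      ay≤ax j = *-monoˡ-≤-nonNeg (a j) {{nonNegative (a≥0 j)}} (y≤x j)
      avg≤b : Σℚ k (λ i → μ i * value i) ≤ b
      avg≤b = ≤-trans (≤-reflexive (sym ay≡avg)) (≤-trans (Σℚ-mono-≤ ay≤ax) (≤-reflexive ax≡b))
      ax≤ay : dot a x ≤ dot a y
      ax≤ay = ≤-trans (≤-reflexive ax≡b)
                (≤-trans (weighted-average-≥ μ≥0 Σμ≡1 b≤value) (≤-reflexive (sym ay≡avg)))
      ye≡xe : y e ≡ x e
      ye≡xe = *-cancelˡ-≡-pos (a e) {{positive ae>0}} (Σℚ-tight ay≤ax ax≤ay e)
      some-term : ∃ λ i → μ i * incidence (δ i) e ≢ 0ℚ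
      some-term = Σℚ-nonZero⇒term-nonZero _ (xe≢0 ∘ trans (sym ye≡xe))
      i = proj₁ some-term
      μi≢0×δie≡true : μ i ≢ 0ℚ × δ i e ≡ true
      μi≢0×δie≡true = *-indicator-nonZero {μ i} {δ i e} (proj₂ some-term)

    -- δ with e uncut and every edge outside supp(a) cut. Its weight is a·χ^δ − a_e < b, so it
    -- fails to separate some pair of S, and since δ separates it, only through e inside supp(a).
    reroute : (Fin m → Bool) → Fin m → Fin m → Bool
    reroute δ e j with j ≟ᶠ e | a j ≟ 0ℚ
    ... | yes _ | _     = false
    ... | no _  | yes _ = true
    ... | no _  | no _  = δ j

    reroute-weight : ∀ {δ e} → δ e ≡ true →
      ∀ j → a j * incidence (reroute δ e) j + a j * unit e j ≡ a j * incidence δ j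
    reroute-weight {δ} {e} δe≡true j with j ≟ᶠ e | a j ≟ 0ℚ
    ... | yes refl | _      rewrite δe≡true = trans (cong (_+ a j * 1ℚ) (*-zeroʳ (a j))) (+-identityˡ _)
    ... | no _     | yes aj≡0 rewrite aj≡0 = trans (*-zeroˡ 1ℚ) (sym (*-zeroˡ [ δ j ]))
    ... | no _     | no _   = trans (cong (a j * [ δ j ] +_) (*-zeroʳ (a j))) (+-identityʳ _)

    reroute-uncut⇒supp : ∀ {δ e j} → a e ≢ 0ℚ → reroute δ e j ≡ false → InSupp a j
    reroute-uncut⇒supp {δ} {e} {j} ae≢0 uncut with j ≟ᶠ e | a j ≟ 0ℚ
    reroute-uncut⇒supp ae≢0 _  | yes refl | _      = ae≢0
    reroute-uncut⇒supp _    () | no _     | yes _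
    reroute-uncut⇒supp _    _  | no _     | no aj≢0 = aj≢0

    reroute-uncut⇒uncut : ∀ {δ e j} → reroute δ e j ≡ false → j ≢ e → δ j ≡ false
    reroute-uncut⇒uncut {δ} {e} {j} uncut j≢e with j ≟ᶠ e | a j ≟ 0ℚ
    reroute-uncut⇒uncut _      j≢e | yes j≡e | _     = contradiction j≡e j≢e
    reroute-uncut⇒uncut ()     _   | no _    | yes _
    reroute-uncut⇒uncut uncut  _   | no _    | no _  = uncut

    reroute-not-Multicut : ∀ {δ e} → a e > 0ℚ → δ e ≡ true → dot a (incidence δ) ≡ b →
      ¬ Multicut ends S (reroute δ e)
    reroute-not-Multicut {δ} {e} ae>0 δe≡true tight cut = <-irrefl refl (<-≤-trans b<b+ae b+ae≤b)
      where
      weight-drop : dot a (incidence (reroute δ e)) + a e ≡ b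
      weight-drop = begin
        dot a χ′ + a e                                 ≡⟨ cong (dot a χ′ +_) (dot-unitʳ a e) ⟨
        dot a χ′ + dot a (unit e)                      ≡⟨ Σℚ-distrib-+ m _ _ ⟨
        Σℚ m (λ j → a j * χ′ j + a j * unit e j)       ≡⟨ Σℚ-cong (reroute-weight δe≡true) ⟩
        dot a (incidence δ)                            ≡⟨ tight ⟩
        b                                              ∎
        where
        open ≡-Reasoning
        χ′ = incidence (reroute δ e)
      b+ae≤b : b + a e ≤ b
      b+ae≤b = ≤-trans (+-monoˡ-≤ (a e) (valid _ (Multicut⇒InMultC cut))) (≤-reflexive weight-drop)
      b<b+ae : b < b + a e
      b<b+ae = <-respˡ-≡ (+-identityʳ b) (+-monoʳ-< b ae>0)

    tight-cut⇒terminal-path : ∀ {δ e} → a e > 0ℚ → Multicut ends S δ → δ e ≡ true →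
      dot a (incidence δ) ≡ b → TerminalPathThrough ends S a e
    tight-cut⇒terminal-path {δ} {e} ae>0 δ-cut δe≡true tight
      with Multicut-or-Connected (reroute δ e)
    ... | inj₁ cut = ⊥-elim (reroute-not-Multicut ae>0 δe≡true tight cut)
    ... | inj₂ (s , t , st∈S , c) with Conn⇒Path ends c
    ...   | vs , es , p with e ∈ᶠ? es
    ...     | yes e∈ = s , t , st∈S , vs , es , Path-mono ends (λ _ → reroute-uncut⇒supp ae≢0) p , e∈
      where
      ae≢0 : a e ≢ 0ℚ
      ae≢0 = ≢-sym (<⇒≢ ae>0)
    ...     | no e∉  = contradiction (Path⇒Conn ends p avoids-δ) (δ-cut st∈S)
      where
      avoids-δ : ∀ f → f ∈ es → δ f ≡ false
      avoids-δ f f∈ = reroute-uncut⇒uncut {δ} {e} {f} (Path-kept ends p f∈) λ { refl → e∉ f∈ }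

facet-leaves-coordinate-hyperplane : ∀ {m} {X : Point m → Set} {a b e} → UpwardClosed X →
  FacetDefining X a b → a e > 0ℚ → ¬ SameAsNonneg a b e →
  ∃ λ x → (X x × dot a x ≡ b) × x e ≢ 0ℚ
facet-leaves-coordinate-hyperplane {a = a} {b} {e} upward (_ , d , (_ , low-dim) , (p , p∈face , indep) , _)
  ae>0 not-same with all? (λ i → p i e ≟ 0ℚ)
... | no not-all = let i , pie≢0 = ¬∀⟶∃¬ _ _ (λ i → p i e ≟ 0ℚ) not-all in p i , p∈face i , pie≢0
... | yes face⊆xe≡0 = ⊥-elim (not-same same-as-nonneg)
  where
  others : ∀ f → f ≢ e → a f ≡ 0ℚ
  others = concentrated-face upward low-dim p (proj₁ ∘ p∈face) (proj₂ ∘ p∈face) indep e face⊆xe≡0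
  b≡0 : b ≡ 0ℚ
  b≡0 = begin
    b                     ≡⟨ proj₂ (p∈face zero) ⟨
    dot a (p zero)        ≡⟨ dot-concentrated a (p zero) e others ⟩
    a e * p zero e        ≡⟨ cong (a e *_) (face⊆xe≡0 zero) ⟩
    a e * 0ℚ              ≡⟨ *-zeroʳ (a e) ⟩
    0ℚ                    ∎
    where open ≡-Reasoning
  same-as-nonneg : SameAsNonneg a b e
  same-as-nonneg = subst (λ c → SameAsNonneg a c e) (sym b≡0) (concentrated⇒SameAsNonneg ae>0 others)

supp-edge⇒terminal-path : ∀ {n m} (ends : Ends n m) (S : Pairs n) → WellFormedPairs S →
  ∀ {a b} → FacetDefining (InMultC ends S) a b → (∀ e' → ¬ SameAsNonneg a b e') →
  ∀ e → InSupp a e → TerminalPathThrough ends S a e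
supp-edge⇒terminal-path ends S well-formed {a} facet not-nonneg e ae≢0 =
  let x , (x∈P , x-tight) , xe≢0 =
        facet-leaves-coordinate-hyperplane {a = a} (InMultC-upward ends S) facet ae>0 (not-nonneg e)
      δ , δ-cut , δe≡true , δ-tight = tight-point⇒tight-cut ends S valid a≥0 ae>0 x∈P x-tight xe≢0
  in tight-cut⇒terminal-path ends S valid ae>0 δ-cut δe≡true δ-tight
  where
  valid = proj₁ facet
  a≥0 : ∀ f → a f ≥ 0ℚ
  a≥0 = valid⇒nonneg (InMultC-upward ends S)
          (Multicut⇒InMultC ends S (cut-all-Multicut ends S well-formed)) valid
  ae>0 : a e > 0ℚ
  ae>0 = positive⁻¹ (a e) {{nonNeg∧nonZero⇒pos (a e) {{nonNegative (a≥0 e)}} {{≢-nonZero ae≢0}}}}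

terminal-path-through-leaf⇒Terminal : ∀ {n m} {ends : Ends n m} {S : Pairs n} {a : Point m} {e v} →
  (∀ f → InSupp a f → Incident ends f v → f ≡ e) → Incident ends e v →
  TerminalPathThrough ends S a e → Terminal S v
terminal-path-through-leaf⇒Terminal {ends = ends} only-e-at-v e-at-v (s , t , st∈S , _ , _ , p , e∈)
  with Path-leaf⇒endpoint ends only-e-at-v p e∈ e-at-v
... | inj₁ refl = t , inj₁ st∈S
... | inj₂ refl = s , inj₂ st∈S

theorem3p3 : ∀ {n m} (ends : Ends n m) → Simple ends →
    (S : Pairs n) → WellFormedPairs S →
    (a : Point m) (b : ℚ) →
    FacetDefining (InMultC ends S) a b →
    (∀ e' → ¬ SameAsNonneg a b e') →
    (∀ e → InSupp a e →
      Σ (Fin n) λ s → Σ (Fin n) λ t →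
        ((s , t) ∈ S) × Σ (List (Fin n)) λ vs → Σ (List (Fin m)) λ es →
          Path ends (InSupp a) s t vs es × (e ∈ es))
    × (∀ v → Leaf ends a v → Terminal S v)
theorem3p3 ends _ S well-formed a b facet not-nonneg = terminal-path , leaf⇒terminal
  where
  terminal-path : ∀ e → InSupp a e → TerminalPathThrough ends S a e
  terminal-path = supp-edge⇒terminal-path ends S well-formed facet not-nonneg
  leaf⇒terminal : ∀ v → Leaf ends a v → Terminal S v
  leaf⇒terminal v (e , ae≢0 , e-at-v , only-e-at-v) =
    terminal-path-through-leaf⇒Terminal only-e-at-v e-at-v (terminal-path e ae≢0)
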